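{- For every integer $k\ge 8$, the path $P_k$ defines the graph $2K_2$ (two disjoint edges); that is, there is a coalition partition $\Psi$ of $P_k$ with $\mathrm{CG}(P_k,\Psi)\cong 2K_2$.
   Context: For a graph $G$ with vertex set $V$, a set $S\subseteq V$ is a dominating set if every vertex of $V\setminus S$ is adjacent to a vertex of $S$. Two disjoint sets $V_1,V_2\subseteq V$ form a coalition in $G$ if neither is a dominating set of $G$ but $V_1\cup V_2$ is. A coalition partition of $G$ is a partition $\Psi=\{V_1,\ldots,V_k\}$ of $V$ such that every $V_i\in\Psi$ is either a dominating set of $G$ with $|V_i|=1$, or is not a dominating set and forms a coalition with some $V_j\in\Psi$. Given a coalition partition $\Psi$ of $G$, the coalition graph $\mathrm{CG}(G,\Psi)$ has vertex set $\Psi$, two members adjacent iff they form a coalition in $G$. $P_k$ is the path on $k$ vertices. -}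

module Defs where

open import Data.Nat using (ℕ; suc; _+_)
open import Data.Fin using (Fin; toℕ)
open import Data.Product using (Σ; ∃; _×_; _,_)
open import Data.Sum using (_⊎_)
open import Relation.Nullary using (¬_)
open import Relation.Binary.PropositionalEquality using (_≡_; _≢_)
open import Function.Bundles using (_↔_; Inverse)
open import Function.Definitions using (Surjective)

record Graph (n : ℕ) : Set₁ where
  field
    Adj : Fin n → Fin n → Set
open Graph public

VSet : ℕ → Set₁
VSet n = Fin n → Set

_∪_ : ∀ {n} → VSet n → VSet n → VSet n
(A ∪ B) v = A v ⊎ B v

Dominating : ∀ {n} → Graph n → VSet n → Set
Dominating G S = ∀ v → S v ⊎ (∃ λ u → S u × Adj G u v)

Path : (k : ℕ) → Graph k
Adj (Path k) i j = (suc (toℕ i) ≡ toℕ j) ⊎ (suc (toℕ j) ≡ toℕ i)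

-- A partition of V(G) = Fin n into m (nonempty) classes, given by the
-- class-assignment map f : Fin n → Fin m, surjective so every class is nonempty.
-- Class i is  V_i = { v | f v ≡ i }.
Class : ∀ {n m} → (Fin n → Fin m) → Fin m → VSet n
Class f i v = f v ≡ i

Singleton : ∀ {n} → VSet n → Set
Singleton S = ∃ λ v → S v × (∀ w → S w → w ≡ v)

Coalition : ∀ {n} → Graph n → VSet n → VSet n → Set
Coalition G A B = ¬ Dominating G A × ¬ Dominating G B × Dominating G (A ∪ B)

-- Classes i ≠ j of a partition are disjoint, so a coalition between classes
-- is a coalition between distinct classes.
CoalitionPartition : ∀ {n m} → Graph n → (Fin n → Fin m) → Set
CoalitionPartition {m = m} G f =
  Surjective _≡_ _≡_ f ×
  (∀ (i : Fin m) →
     (Dominating G (Class f i) × Singleton (Class f i))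
     ⊎ (¬ Dominating G (Class f i) ×
        (∃ λ j → j ≢ i × Coalition G (Class f i) (Class f j))))

CoalitionGraph : ∀ {n m} → Graph n → (Fin n → Fin m) → Graph m
Adj (CoalitionGraph G f) i j = i ≢ j × Coalition G (Class f i) (Class f j)

_≅_ : ∀ {m n} → Graph m → Graph n → Set
_≅_ {m} {n} G H = Σ (Fin m ↔ Fin n) λ σ →
  ∀ a b → (Adj G a b → Adj H (Inverse.to σ a) (Inverse.to σ b))
        × (Adj H (Inverse.to σ a) (Inverse.to σ b) → Adj G a b)

data TwoK2Adj : Fin 4 → Fin 4 → Set where
  e01 : TwoK2Adj Fin.zero (Fin.suc Fin.zero)
  e10 : TwoK2Adj (Fin.suc Fin.zero) Fin.zero
  e23 : TwoK2Adj (Fin.suc (Fin.suc Fin.zero)) (Fin.suc (Fin.suc (Fin.suc Fin.zero)))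
  e32 : TwoK2Adj (Fin.suc (Fin.suc (Fin.suc Fin.zero))) (Fin.suc (Fin.suc Fin.zero))

TwoK2 : Graph 4
Adj TwoK2 = TwoK2Adj

-- Colour the path 0 — 1 — ⋯ — (k-1) by
--   A C A D D B B C B C B C ⋯
-- The classes A, B together dominate, as do C, D, while each "crossing" pair
-- leaves some vertex undominated: A∪C misses 4, A∪D misses 6, B∪C misses 3 and
-- B∪D misses 0.  So no single class dominates, the coalitions are exactly
-- {A,B} and {C,D}, and the coalition graph is 2K₂.  Vertex 7 must exist, which
-- is where k ≥ 8 is used.
module Submission where

open import Defs
open import Data.Nat using (ℕ; suc; _+_; _≤_; pred)
open import Data.Nat.Properties using (m≤n⇒∃[o]m+o≡n)
open import Data.Fin using (Fin; toℕ; inject₁; #_)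
open import Data.Fin.Properties using (toℕ-inject₁)
open import Data.Product using (Σ; ∃; _×_; _,_)
open import Data.Sum using (_⊎_; inj₁; inj₂; swap; [_,_]′)
open import Data.Empty using (⊥-elim)
open import Function using (_∘_)
open import Function.Construct.Identity using (↔-id)
open import Function.Consequences.Propositional using (strictlySurjective⇒surjective)
open import Relation.Nullary using (¬_)
open import Relation.Unary using (_⊆_)
open import Relation.Binary.PropositionalEquality using (_≡_; _≢_; refl; sym; cong; subst)

DominatedBy : ∀ {n} → Graph n → VSet n → Fin n → Set
DominatedBy G S v = S v ⊎ ∃ λ u → S u × Adj G u v

Dominating-mono : ∀ {n} (G : Graph n) {S T : VSet n} → S ⊆ T → Dominating G S → Dominating G T
Dominating-mono G S⊆T d v with d v
... | inj₁ s           = inj₁ (S⊆T s)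
... | inj₂ (u , s , a) = inj₂ (u , S⊆T s , a)

Dominating-∪-comm : ∀ {n} (G : Graph n) {S T : VSet n} → Dominating G (S ∪ T) → Dominating G (T ∪ S)
Dominating-∪-comm G = Dominating-mono G swap

¬Dominating-∪ˡ : ∀ {n} (G : Graph n) {S T : VSet n} → ¬ Dominating G (S ∪ T) → ¬ Dominating G S
¬Dominating-∪ˡ G ¬d = ¬d ∘ Dominating-mono G inj₁

¬Dominating-∪ʳ : ∀ {n} (G : Graph n) {S T : VSet n} → ¬ Dominating G (S ∪ T) → ¬ Dominating G T
¬Dominating-∪ʳ G ¬d = ¬d ∘ Dominating-mono G inj₂

pattern A = Fin.zero
pattern B = Fin.suc Fin.zero
pattern C = Fin.suc (Fin.suc Fin.zero)
pattern D = Fin.suc (Fin.suc (Fin.suc Fin.zero))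

partner : Fin 4 → Fin 4
partner A = B
partner B = A
partner C = D
partner D = C

TwoK2Adj-partner : ∀ a → TwoK2Adj a (partner a)
TwoK2Adj-partner A = e01
TwoK2Adj-partner B = e10
TwoK2Adj-partner C = e23
TwoK2Adj-partner D = e32

TwoK2Adj-irrefl : ∀ {a b} → TwoK2Adj a b → a ≢ b
TwoK2Adj-irrefl e01 ()
TwoK2Adj-irrefl e10 ()
TwoK2Adj-irrefl e23 ()
TwoK2Adj-irrefl e32 ()

module FourClasses {n} (G : Graph n) (f : Fin n → Fin 4)
  (surjective : ∀ a → ∃ λ v → f v ≡ a)
  (AB : Dominating G (Class f A ∪ Class f B)) (CD : Dominating G (Class f C ∪ Class f D))
  (¬AC : ¬ Dominating G (Class f A ∪ Class f C)) (¬AD : ¬ Dominating G (Class f A ∪ Class f D))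
  (¬BC : ¬ Dominating G (Class f B ∪ Class f C)) (¬BD : ¬ Dominating G (Class f B ∪ Class f D))
  where

  V : Fin 4 → VSet n
  V = Class f

  ¬Dominating-class : ∀ a → ¬ Dominating G (V a)
  ¬Dominating-class A = ¬Dominating-∪ˡ G ¬AC
  ¬Dominating-class B = ¬Dominating-∪ˡ G ¬BD
  ¬Dominating-class C = ¬Dominating-∪ʳ G ¬AC
  ¬Dominating-class D = ¬Dominating-∪ʳ G ¬BD

  Dominating-edge : ∀ {a b} → TwoK2Adj a b → Dominating G (V a ∪ V b)
  Dominating-edge e01 = AB
  Dominating-edge e10 = Dominating-∪-comm G AB
  Dominating-edge e23 = CD
  Dominating-edge e32 = Dominating-∪-comm G CD

  coalition-edge : ∀ {a b} → TwoK2Adj a b → Coalition G (V a) (V b)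
  coalition-edge {a} {b} e = ¬Dominating-class a , ¬Dominating-class b , Dominating-edge e

  Dominating⇒TwoK2Adj : ∀ a b → a ≢ b → Dominating G (V a ∪ V b) → TwoK2Adj a b
  Dominating⇒TwoK2Adj A A a≢b _ = ⊥-elim (a≢b refl)
  Dominating⇒TwoK2Adj B B a≢b _ = ⊥-elim (a≢b refl)
  Dominating⇒TwoK2Adj C C a≢b _ = ⊥-elim (a≢b refl)
  Dominating⇒TwoK2Adj D D a≢b _ = ⊥-elim (a≢b refl)
  Dominating⇒TwoK2Adj A B _ _ = e01
  Dominating⇒TwoK2Adj B A _ _ = e10
  Dominating⇒TwoK2Adj C D _ _ = e23
  Dominating⇒TwoK2Adj D C _ _ = e32
  Dominating⇒TwoK2Adj A C _ d = ⊥-elim (¬AC d)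
  Dominating⇒TwoK2Adj A D _ d = ⊥-elim (¬AD d)
  Dominating⇒TwoK2Adj B C _ d = ⊥-elim (¬BC d)
  Dominating⇒TwoK2Adj B D _ d = ⊥-elim (¬BD d)
  Dominating⇒TwoK2Adj C A _ d = ⊥-elim (¬AC (Dominating-∪-comm G d))
  Dominating⇒TwoK2Adj D A _ d = ⊥-elim (¬AD (Dominating-∪-comm G d))
  Dominating⇒TwoK2Adj C B _ d = ⊥-elim (¬BC (Dominating-∪-comm G d))
  Dominating⇒TwoK2Adj D B _ d = ⊥-elim (¬BD (Dominating-∪-comm G d))

  coalitionPartition : CoalitionPartition G f
  coalitionPartition = strictlySurjective⇒surjective surjective , λ a →
    inj₂ (¬Dominating-class a , partner a ,
          TwoK2Adj-irrefl (TwoK2Adj-partner a) ∘ sym , coalition-edge (TwoK2Adj-partner a))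

  coalitionGraph≅TwoK2 : CoalitionGraph G f ≅ TwoK2
  coalitionGraph≅TwoK2 = ↔-id _ , λ a b →
    (λ (a≢b , _ , _ , d) → Dominating⇒TwoK2Adj a b a≢b d) ,
    (λ e → TwoK2Adj-irrefl e , coalition-edge e)

Path-DominatedBy-predecessor : ∀ {k} (P : ℕ → Set) (v : Fin k) →
  P (toℕ v) → DominatedBy (Path (suc k)) (P ∘ toℕ) (Fin.suc v)
Path-DominatedBy-predecessor P v p =
  inj₂ (inject₁ v , subst P (sym (toℕ-inject₁ v)) p , inj₁ (cong suc (toℕ-inject₁ v)))

-- For v = 0 the first hypothesis is about pred 0 = 0 itself.
Path-¬Dominating : ∀ {k} (P : ℕ → Set) (v : Fin k) →
  ¬ P (pred (toℕ v)) → ¬ P (toℕ v) → ¬ P (suc (toℕ v)) → ¬ Dominating (Path k) (P ∘ toℕ)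
Path-¬Dominating P v ¬p₋ ¬p ¬p₊ d with d v
... | inj₁ p                  = ¬p p
... | inj₂ (u , p , inj₁ u+1≡v) = ¬p₋ (subst P (cong pred u+1≡v) p)
... | inj₂ (u , p , inj₂ v+1≡u) = ¬p₊ (subst P (sym v+1≡u) p)

colour : ℕ → Fin 4
colour 0 = A
colour 1 = C
colour 2 = A
colour 3 = D
colour 4 = D
colour 5 = B
colour 6 = B
colour 7 = C
colour (suc (suc n@(suc (suc (suc (suc (suc (suc _)))))))) = colour n

colour-tail : ∀ n → (colour (6 + n) ≡ B × colour (7 + n) ≡ C) ⊎ (colour (6 + n) ≡ C × colour (7 + n) ≡ B)
colour-tail 0             = inj₁ (refl , refl)
colour-tail 1             = inj₂ (refl , refl)
colour-tail (suc (suc n)) = colour-tail n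

Coloured : Fin 4 → Fin 4 → ℕ → Set
Coloured a b i = colour i ≡ a ⊎ colour i ≡ b

module ColouredPath (r : ℕ) where

  G : Graph (8 + r)
  G = Path (8 + r)

  Ψ : Fin (8 + r) → Fin 4
  Ψ = colour ∘ toℕ

  pattern v0 = Fin.zero
  pattern v1 = Fin.suc v0
  pattern v2 = Fin.suc v1
  pattern v3 = Fin.suc v2
  pattern v4 = Fin.suc v3
  pattern v5 = Fin.suc v4
  pattern v6 = Fin.suc v5
  pattern suc⁶ w = Fin.suc (Fin.suc (Fin.suc (Fin.suc (Fin.suc (Fin.suc w)))))

  Dominating-AB : Dominating G (Class Ψ A ∪ Class Ψ B)
  Dominating-AB v0 = inj₁ (inj₁ refl)
  Dominating-AB v1 = inj₂ (# 0 , inj₁ refl , inj₁ refl)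
  Dominating-AB v2 = inj₁ (inj₁ refl)
  Dominating-AB v3 = inj₂ (# 2 , inj₁ refl , inj₁ refl)
  Dominating-AB v4 = inj₂ (# 5 , inj₂ refl , inj₂ refl)
  Dominating-AB v5 = inj₁ (inj₂ refl)
  Dominating-AB v6 = inj₁ (inj₂ refl)
  Dominating-AB (Fin.suc w@(suc⁶ u)) with colour-tail (toℕ u)
  ... | inj₁ (pred≡B , _) = Path-DominatedBy-predecessor (Coloured A B) w (inj₂ pred≡B)
  ... | inj₂ (_ , self≡B) = inj₁ (inj₂ self≡B)

  Dominating-CD : Dominating G (Class Ψ C ∪ Class Ψ D)
  Dominating-CD v0 = inj₂ (# 1 , inj₁ refl , inj₂ refl)
  Dominating-CD v1 = inj₁ (inj₁ refl)
  Dominating-CD v2 = inj₂ (# 1 , inj₁ refl , inj₁ refl)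
  Dominating-CD v3 = inj₁ (inj₂ refl)
  Dominating-CD v4 = inj₁ (inj₂ refl)
  Dominating-CD v5 = inj₂ (# 4 , inj₂ refl , inj₁ refl)
  Dominating-CD v6 = inj₂ (# 7 , inj₁ refl , inj₂ refl)
  Dominating-CD (Fin.suc w@(suc⁶ u)) with colour-tail (toℕ u)
  ... | inj₁ (_ , self≡C) = inj₁ (inj₁ self≡C)
  ... | inj₂ (pred≡C , _) = Path-DominatedBy-predecessor (Coloured C D) w (inj₁ pred≡C)

  ¬Dominating-AC : ¬ Dominating G (Class Ψ A ∪ Class Ψ C)
  ¬Dominating-AC = Path-¬Dominating (Coloured A C) (# 4)
    [ (λ ()) , (λ ()) ]′ [ (λ ()) , (λ ()) ]′ [ (λ ()) , (λ ()) ]′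

  ¬Dominating-AD : ¬ Dominating G (Class Ψ A ∪ Class Ψ D)
  ¬Dominating-AD = Path-¬Dominating (Coloured A D) (# 6)
    [ (λ ()) , (λ ()) ]′ [ (λ ()) , (λ ()) ]′ [ (λ ()) , (λ ()) ]′

  ¬Dominating-BC : ¬ Dominating G (Class Ψ B ∪ Class Ψ C)
  ¬Dominating-BC = Path-¬Dominating (Coloured B C) (# 3)
    [ (λ ()) , (λ ()) ]′ [ (λ ()) , (λ ()) ]′ [ (λ ()) , (λ ()) ]′

  ¬Dominating-BD : ¬ Dominating G (Class Ψ B ∪ Class Ψ D)
  ¬Dominating-BD = Path-¬Dominating (Coloured B D) (# 0)
    [ (λ ()) , (λ ()) ]′ [ (λ ()) , (λ ()) ]′ [ (λ ()) , (λ ()) ]′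

  Ψ-surjective : ∀ a → ∃ λ v → Ψ v ≡ a
  Ψ-surjective A = # 0 , refl
  Ψ-surjective B = # 5 , refl
  Ψ-surjective C = # 1 , refl
  Ψ-surjective D = # 3 , refl

  open FourClasses G Ψ Ψ-surjective Dominating-AB Dominating-CD
    ¬Dominating-AC ¬Dominating-AD ¬Dominating-BC ¬Dominating-BD public

proposition9 : (k : ℕ) → 8 ≤ k →
    ∃ λ m → Σ (Fin k → Fin m) λ Ψ →
      CoalitionPartition (Path k) Ψ × (CoalitionGraph (Path k) Ψ ≅ TwoK2)
proposition9 k 8≤k with m≤n⇒∃[o]m+o≡n 8≤k
... | r , refl = 4 , Ψ , coalitionPartition , coalitionGraph≅TwoK2
  where open ColouredPath r
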